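{- Let $N>1$ be odd and let $\Gamma$ be a lift of $\overline{\Gamma(N)}$ which is a congruence subgroup and satisfies $-1\notin\Gamma$. For $A\in\Gamma$ let $A_0$ be the unique element of $\Gamma(N)$ with the same image as $A$ in $\mathrm{PSL}_2(\mathbb Z)$, and define the sign $\sigma(A)=1$ if $A=A_0$ and $\sigma(A)=-1$ if $A=-A_0$. Let $T_N$ be the element of $\Gamma$ lying over the image of $T^N=\begin{pmatrix}1&N\\0&1\end{pmatrix}$. Then the sign $\sigma(T_N)$ determines $\sigma(A)$ for every $A\in\Gamma$; consequently, two such lifts with the same value of $\sigma(T_N)$ coincide.
   Context: $\Gamma(N)=\{A\in\mathrm{SL}_2(\mathbb Z):A\equiv1\pmod N\}$; for $N>2$, $-1\notin\Gamma(N)$, so each element of $\overline{\Gamma(N)}$ (image in $\mathrm{PSL}_2(\mathbb Z)$) has a unique preimage in $\Gamma(N)$. A lift of $\overline{\Gamma(N)}$ is a subgroup of $\mathrm{SL}_2(\mathbb Z)$ with image $\overline{\Gamma(N)}$ in $\mathrm{PSL}_2(\mathbb Z)$; it is a congruence subgroup if it contains $\Gamma(M)$ for some $M$. -}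

module Defs where

open import Data.Nat as ℕ using (ℕ)
open import Data.Integer using (ℤ; +_; -_; _+_; _-_; _*_; 1ℤ; 0ℤ)
open import Data.Integer.Divisibility using (_∣_)
open import Data.Sign using (Sign)
open import Data.Product using (_×_; Σ; ∃)
open import Data.Sum using (_⊎_)
open import Relation.Binary.PropositionalEquality using (_≡_)
open import Relation.Nullary using (¬_)

record Mat : Set where
  constructor mat
  field
    a b c d : ℤ

open Mat public

det : Mat → ℤ
det (mat a b c d) = a * d - b * c

SL₂ : Mat → Set
SL₂ A = det A ≡ 1ℤ

_·_ : Mat → Mat → Mat
mat a b c d · mat a' b' c' d' =
  mat (a * a' + b * c') (a * b' + b * d') (c * a' + d * c') (c * b' + d * d')

-- inverse of an SL₂ matrix (adjugate)
inv : Mat → Mat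
inv (mat a b c d) = mat d (- b) (- c) a

neg : Mat → Mat
neg (mat a b c d) = mat (- a) (- b) (- c) (- d)

I : Mat
I = mat 1ℤ 0ℤ 0ℤ 1ℤ

Tpow : ℕ → Mat
Tpow N = mat 1ℤ (+ N) 0ℤ 1ℤ

≡I-mod : ℕ → Mat → Set
≡I-mod M (mat a b c d) =
  (+ M ∣ (a - 1ℤ)) × (+ M ∣ b) × (+ M ∣ c) × (+ M ∣ (d - 1ℤ))

Γ : ℕ → Mat → Set
Γ M A = SL₂ A × ≡I-mod M A

record IsSubgroupSL₂ (G : Mat → Set) : Set where
  field
    ⊆SL₂   : ∀ A → G A → SL₂ A
    has-I  : G I
    ·-closed   : ∀ A B → G A → G B → G (A · B)
    inv-closed : ∀ A → G A → G (inv A)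

-- a lift of the image of Γ(N) in PSL₂(ℤ): a subgroup whose image in PSL₂(ℤ)
-- equals that of Γ(N), i.e. G ∪ -G = Γ(N) ∪ -Γ(N)
record IsLift (N : ℕ) (G : Mat → Set) : Set where
  field
    subgroup : IsSubgroupSL₂ G
    image⊆ : ∀ A → G A → Γ N A ⊎ Γ N (neg A)
    image⊇ : ∀ A → Γ N A → G A ⊎ G (neg A)

IsCongruence : (Mat → Set) → Set
IsCongruence G = Σ ℕ λ M → (M ℕ.≥ 1) × (∀ A → Γ M A → G A)

-- the lift of A₀ ∈ Γ(N) in G has sign s: (+) means A₀ ∈ G, (-) means -A₀ ∈ G
HasSign : (Mat → Set) → Mat → Sign → Set
HasSign G A₀ Sign.+ = G A₀
HasSign G A₀ Sign.- = G (neg A₀)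

record GoodLift (N : ℕ) (G : Mat → Set) : Set where
  field
    lift       : IsLift N G
    congruence : IsCongruence G
    no-minus-1 : ¬ G (neg I)

{-# OPTIONS --safe #-}

-- Let K be the set of A ∈ SL₂(ℤ) on which two lifts agree: both contain A or both contain −A.
-- K is a subgroup normalised by Γ(N) containing every square of Γ(N) (a lift contains A or −A,
-- hence A²), T^N, and Γ(M₁M₂) (both lifts are congruence subgroups); for odd N any such K
-- contains Γ(N). Write M₁M₂ ∣ 2^(e+1) N^(e+1) q with q prime to 2N. Since SL₂(ℤ) is generated by
-- elementary matrices, whose entries may be changed by the Chinese remainder theorem, every
-- A ∈ Γ(N) is a product of powers of T^N and U^N, both in K, and of some X ≡ I (mod 2^(e+1)).
-- Squares of elementary matrices in Γ(N) make X ≡ I (mod q) as well; then X^(N^e) ≡ I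
-- (mod N^(e+1)) lies in Γ(M₁M₂) ⊆ K, and as N is odd and K contains squares, so does X.

module Submission where

open import Defs
open import Data.Bool using (Bool; true; false)
open import Data.Empty using (⊥-elim)
open import Data.Integer as ℤ
  using (ℤ; +_; -_; _+_; _-_; _*_; _^_; 1ℤ; 0ℤ; -1ℤ; ∣_∣; -[1+_])
import Data.Integer.DivMod as ℤ
import Data.Integer.Properties as ℤ
open import Data.Integer.Divisibility.Signed
  using (_∣_; divides; ∣-refl; ∣-trans; ∣m∣n⇒∣m+n; ∣m⇒∣-m; ∣n⇒∣m*n; ∣m⇒∣m*n; *-monoʳ-∣; *-monoˡ-∣; ∣ᵤ⇒∣; ∣⇒∣ᵤ)
open import Data.Integer.Tactic.RingSolver using (solve-∀)
open import Data.List using (List; []; _∷_; _++_)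
open import Data.Nat as ℕ using (ℕ; zero; suc; _>_)
import Data.Nat.Coprimality as ℕ
import Data.Nat.Divisibility as ℕ
import Data.Nat.DivMod as ℕ
open import Data.Nat.DivMod using (_%_)
import Data.Nat.GCD as ℕ
open import Data.Nat.Induction using (<-rec)
import Data.Nat.Properties as ℕ
import Data.Nat.Tactic.RingSolver as ℕ
open import Data.Product using (_×_; _,_; proj₁; proj₂; Σ; ∃; ∃₂)
open import Data.Sign using (Sign)
open import Data.Sum using (_⊎_; inj₁; inj₂)
open import Function.Bundles using (_⇔_; mk⇔; Equivalence)
open import Relation.Binary.PropositionalEquality
open import Relation.Nullary using (¬_; yes; no)

mat-cong : ∀ {a b c d a′ b′ c′ d′} → a ≡ a′ → b ≡ b′ → c ≡ c′ → d ≡ d′ →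
           mat a b c d ≡ mat a′ b′ c′ d′
mat-cong refl refl refl refl = refl

·-assoc : ∀ A B C → (A · B) · C ≡ A · (B · C)
·-assoc (mat a b c d) (mat e f g h) (mat i j k l) =
  mat-cong (entry a b e f g h i k) (entry a b e f g h j l) (entry c d e f g h i k) (entry c d e f g h j l)
  where
  entry : ∀ a b e f g h i k →
          (a * e + b * g) * i + (a * f + b * h) * k ≡ a * (e * i + f * k) + b * (g * i + h * k)
  entry = solve-∀

·-identityˡ : ∀ A → I · A ≡ A
·-identityˡ (mat a b c d) = mat-cong (first a c) (first b d) (second a c) (second b d)
  where
  first : ∀ x y → 1ℤ * x + 0ℤ * y ≡ x
  first = solve-∀
  second : ∀ x y → 0ℤ * x + 1ℤ * y ≡ y
  second = solve-∀

·-identityʳ : ∀ A → A · I ≡ A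
·-identityʳ (mat a b c d) = mat-cong (first a b) (second a b) (first c d) (second c d)
  where
  first : ∀ x y → x * 1ℤ + y * 0ℤ ≡ x
  first = solve-∀
  second : ∀ x y → x * 0ℤ + y * 1ℤ ≡ y
  second = solve-∀

det-· : ∀ A B → det (A · B) ≡ det A * det B
det-· (mat a b c d) (mat e f g h) = identity a b c d e f g h
  where
  identity : ∀ a b c d e f g h →
             (a * e + b * g) * (c * f + d * h) - (a * f + b * h) * (c * e + d * g)
             ≡ (a * d - b * c) * (e * h - f * g)
  identity = solve-∀

det-inv : ∀ A → det (inv A) ≡ det A
det-inv (mat a b c d) = identity a b c d
  where
  identity : ∀ a b c d → d * a - (- b) * (- c) ≡ a * d - b * c
  identity = solve-∀

·-inverseʳ : ∀ A → SL₂ A → A · inv A ≡ I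
·-inverseʳ (mat a b c d) det≡1 =
  mat-cong (trans (diag₁ a b c d) det≡1) (off₁ b a) (off₂ c d) (trans (diag₂ a b c d) det≡1)
  where
  diag₁ : ∀ a b c d → a * d + b * (- c) ≡ a * d - b * c
  diag₁ = solve-∀
  diag₂ : ∀ a b c d → c * (- b) + d * a ≡ a * d - b * c
  diag₂ = solve-∀
  off₁ : ∀ x y → y * (- x) + x * y ≡ 0ℤ
  off₁ = solve-∀
  off₂ : ∀ x y → x * y + y * (- x) ≡ 0ℤ
  off₂ = solve-∀

·-inverseˡ : ∀ A → SL₂ A → inv A · A ≡ I
·-inverseˡ (mat a b c d) det≡1 =
  mat-cong (trans (diag₁ a b c d) det≡1) (off₁ b d) (off₂ c a) (trans (diag₂ a b c d) det≡1)
  where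
  diag₁ : ∀ a b c d → d * a + (- b) * c ≡ a * d - b * c
  diag₁ = solve-∀
  diag₂ : ∀ a b c d → (- c) * b + a * d ≡ a * d - b * c
  diag₂ = solve-∀
  off₁ : ∀ x y → y * x + (- x) * y ≡ 0ℤ
  off₁ = solve-∀
  off₂ : ∀ x y → (- x) * y + y * x ≡ 0ℤ
  off₂ = solve-∀

neg-distribˡ-· : ∀ A B → neg A · B ≡ neg (A · B)
neg-distribˡ-· (mat a b c d) (mat e f g h) =
  mat-cong (entry a b e g) (entry a b f h) (entry c d e g) (entry c d f h)
  where
  entry : ∀ a b e g → (- a) * e + (- b) * g ≡ - (a * e + b * g)
  entry = solve-∀

neg-distribʳ-· : ∀ A B → A · neg B ≡ neg (A · B)
neg-distribʳ-· (mat a b c d) (mat e f g h) =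
  mat-cong (entry a b e g) (entry a b f h) (entry c d e g) (entry c d f h)
  where
  entry : ∀ a b e g → a * (- e) + b * (- g) ≡ - (a * e + b * g)
  entry = solve-∀

neg-involutive : ∀ A → neg (neg A) ≡ A
neg-involutive (mat a b c d) =
  mat-cong (ℤ.neg-involutive a) (ℤ.neg-involutive b) (ℤ.neg-involutive c) (ℤ.neg-involutive d)

neg-·-neg : ∀ A B → neg A · neg B ≡ A · B
neg-·-neg A B = begin
  neg A · neg B     ≡⟨ neg-distribˡ-· A (neg B) ⟩
  neg (A · neg B)   ≡⟨ cong neg (neg-distribʳ-· A B) ⟩
  neg (neg (A · B)) ≡⟨ neg-involutive (A · B) ⟩
  A · B             ∎
  where open ≡-Reasoning

SL₂-· : ∀ A B → SL₂ A → SL₂ B → SL₂ (A · B)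
SL₂-· A B detA≡1 detB≡1 = begin
  det (A · B)     ≡⟨ det-· A B ⟩
  det A * det B   ≡⟨ cong₂ _*_ detA≡1 detB≡1 ⟩
  1ℤ              ∎
  where open ≡-Reasoning

SL₂-inv : ∀ A → SL₂ A → SL₂ (inv A)
SL₂-inv A detA≡1 = trans (det-inv A) detA≡1

[A·B⁻¹]·B≡A : ∀ A B → SL₂ B → (A · inv B) · B ≡ A
[A·B⁻¹]·B≡A A B detB≡1 = begin
  (A · inv B) · B ≡⟨ ·-assoc A (inv B) B ⟩
  A · (inv B · B) ≡⟨ cong (A ·_) (·-inverseˡ B detB≡1) ⟩
  A · I           ≡⟨ ·-identityʳ A ⟩
  A               ∎
  where open ≡-Reasoning

[A·B]·B⁻¹≡A : ∀ A B → SL₂ B → (A · B) · inv B ≡ A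
[A·B]·B⁻¹≡A A B detB≡1 = begin
  (A · B) · inv B ≡⟨ ·-assoc A B (inv B) ⟩
  A · (B · inv B) ≡⟨ cong (A ·_) (·-inverseʳ B detB≡1) ⟩
  A · I           ≡⟨ ·-identityʳ A ⟩
  A               ∎
  where open ≡-Reasoning

A·[A⁻¹·B]≡B : ∀ A B → SL₂ A → A · (inv A · B) ≡ B
A·[A⁻¹·B]≡B A B detA≡1 = begin
  A · (inv A · B) ≡⟨ ·-assoc A (inv A) B ⟨
  (A · inv A) · B ≡⟨ cong (_· B) (·-inverseʳ A detA≡1) ⟩
  I · B           ≡⟨ ·-identityˡ B ⟩
  B               ∎
  where open ≡-Reasoning

infix 4 _≡[_]_ _≋[_]_

record _≡[_]_ (x m y : ℤ) : Set where
  constructor mod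
  field ∣x-y : m ∣ x - y

open _≡[_]_

∣0 : ∀ {m} → m ∣ 0ℤ
∣0 = divides 0ℤ refl

*-pres-∣ : ∀ {m n u v} → m ∣ u → n ∣ v → m * n ∣ u * v
*-pres-∣ {m} {n} (divides k refl) (divides l refl) = divides (k * l) (identity k l m n)
  where
  identity : ∀ k l m n → (k * m) * (l * n) ≡ (k * l) * (m * n)
  identity = solve-∀

≡⇒≡[] : ∀ {m x y} → x ≡ y → x ≡[ m ] y
≡⇒≡[] {m} {x} refl = mod (subst (m ∣_) (sym (ℤ.+-inverseʳ x)) ∣0)

≡[]-refl : ∀ {m x} → x ≡[ m ] x
≡[]-refl = ≡⇒≡[] refl

≡[]-trans : ∀ {m x y z} → x ≡[ m ] y → y ≡[ m ] z → x ≡[ m ] z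
≡[]-trans {m} {x} {y} {z} (mod p) (mod q) = mod (subst (m ∣_) (identity x y z) (∣m∣n⇒∣m+n p q))
  where
  identity : ∀ x y z → (x - y) + (y - z) ≡ x - z
  identity = solve-∀

≡[]-+ : ∀ {m x y u v} → x ≡[ m ] y → u ≡[ m ] v → x + u ≡[ m ] y + v
≡[]-+ {m} {x} {y} {u} {v} (mod p) (mod q) = mod (subst (m ∣_) (identity x y u v) (∣m∣n⇒∣m+n p q))
  where
  identity : ∀ x y u v → (x - y) + (u - v) ≡ (x + u) - (y + v)
  identity = solve-∀

≡[]-* : ∀ {m x y u v} → x ≡[ m ] y → u ≡[ m ] v → x * u ≡[ m ] y * v
≡[]-* {m} {x} {y} {u} {v} (mod p) (mod q) =
  mod (subst (m ∣_) (identity x y u v) (∣m∣n⇒∣m+n (∣m⇒∣m*n u p) (∣n⇒∣m*n y q)))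
  where
  identity : ∀ x y u v → (x - y) * u + y * (u - v) ≡ x * u - y * v
  identity = solve-∀

≡[]-neg : ∀ {m x y} → x ≡[ m ] y → - x ≡[ m ] - y
≡[]-neg {m} {x} {y} (mod p) = mod (subst (m ∣_) (identity x y) (∣m⇒∣-m p))
  where
  identity : ∀ x y → - (x - y) ≡ (- x) - (- y)
  identity = solve-∀

≡[]-∣ : ∀ {m m′ x y} → m ∣ m′ → x ≡[ m′ ] y → x ≡[ m ] y
≡[]-∣ m∣m′ (mod p) = mod (∣-trans m∣m′ p)

∣⇔≡[]0 : ∀ {m x} → m ∣ x ⇔ x ≡[ m ] 0ℤ
∣⇔≡[]0 {m} {x} = mk⇔ (λ p → mod (subst (m ∣_) (sym (x-0≡x x)) p)) (λ (mod p) → subst (m ∣_) (x-0≡x x) p)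
  where
  x-0≡x : ∀ x → x - 0ℤ ≡ x
  x-0≡x = solve-∀

record _≋[_]_ (A : Mat) (m : ℤ) (B : Mat) : Set where
  constructor entries
  field
    a≋ : a A ≡[ m ] a B
    b≋ : b A ≡[ m ] b B
    c≋ : c A ≡[ m ] c B
    d≋ : d A ≡[ m ] d B

open _≋[_]_

≋-reflexive : ∀ {m A B} → A ≡ B → A ≋[ m ] B
≋-reflexive refl = entries ≡[]-refl ≡[]-refl ≡[]-refl ≡[]-refl

≋-refl : ∀ {m A} → A ≋[ m ] A
≋-refl = ≋-reflexive refl

≋-trans : ∀ {m A B C} → A ≋[ m ] B → B ≋[ m ] C → A ≋[ m ] C
≋-trans p q = entries (≡[]-trans (a≋ p) (a≋ q)) (≡[]-trans (b≋ p) (b≋ q))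
                      (≡[]-trans (c≋ p) (c≋ q)) (≡[]-trans (d≋ p) (d≋ q))

≋-· : ∀ {m A A′ B B′} → A ≋[ m ] A′ → B ≋[ m ] B′ → A · B ≋[ m ] A′ · B′
≋-· p q = entries
  (≡[]-+ (≡[]-* (a≋ p) (a≋ q)) (≡[]-* (b≋ p) (c≋ q))) (≡[]-+ (≡[]-* (a≋ p) (b≋ q)) (≡[]-* (b≋ p) (d≋ q)))
  (≡[]-+ (≡[]-* (c≋ p) (a≋ q)) (≡[]-* (d≋ p) (c≋ q))) (≡[]-+ (≡[]-* (c≋ p) (b≋ q)) (≡[]-* (d≋ p) (d≋ q)))

≋-inv : ∀ {m A B} → A ≋[ m ] B → inv A ≋[ m ] inv B
≋-inv p = entries (d≋ p) (≡[]-neg (b≋ p)) (≡[]-neg (c≋ p)) (a≋ p)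

≋-∣ : ∀ {m m′ A B} → m ∣ m′ → A ≋[ m′ ] B → A ≋[ m ] B
≋-∣ m∣m′ p = entries (≡[]-∣ m∣m′ (a≋ p)) (≡[]-∣ m∣m′ (b≋ p)) (≡[]-∣ m∣m′ (c≋ p)) (≡[]-∣ m∣m′ (d≋ p))

Γ⇔SL₂×≋I : ∀ {M A} → Γ M A ⇔ (SL₂ A × A ≋[ + M ] I)
Γ⇔SL₂×≋I = mk⇔
  (λ (detA≡1 , p , q , r , s) → detA≡1 , entries (mod (∣ᵤ⇒∣ p)) (Equivalence.to ∣⇔≡[]0 (∣ᵤ⇒∣ q))
                                                (Equivalence.to ∣⇔≡[]0 (∣ᵤ⇒∣ r)) (mod (∣ᵤ⇒∣ s)))
  (λ (detA≡1 , A≋I) → detA≡1 , ∣⇒∣ᵤ (∣x-y (a≋ A≋I)) , ∣⇒∣ᵤ (Equivalence.from ∣⇔≡[]0 (b≋ A≋I)) ,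
                               ∣⇒∣ᵤ (Equivalence.from ∣⇔≡[]0 (c≋ A≋I)) , ∣⇒∣ᵤ (∣x-y (d≋ A≋I)))

SL₂×≋I⇒Γ : ∀ {M A} → SL₂ A → A ≋[ + M ] I → Γ M A
SL₂×≋I⇒Γ detA≡1 A≋I = Equivalence.from Γ⇔SL₂×≋I (detA≡1 , A≋I)

Bézout : ℤ → ℤ → Set
Bézout a b = ∃₂ λ u v → u * a + v * b ≡ 1ℤ

Bézout-sym : ∀ {a b} → Bézout a b → Bézout b a
Bézout-sym {a} {b} (u , v , eq) = v , u , trans (ℤ.+-comm (v * b) (u * a)) eq

Bézout-*ʳ : ∀ {a b c} → Bézout a b → Bézout a c → Bézout a (b * c)
Bézout-*ʳ {a} {b} {c} (u , v , eq) (u′ , v′ , eq′) =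
  u * u′ * a + u * v′ * c + v * b * u′ , v * v′ ,
  trans (identity u v u′ v′ a b c) (cong₂ _*_ eq eq′)
  where
  identity : ∀ u v u′ v′ a b c →
             (u * u′ * a + u * v′ * c + v * b * u′) * a + (v * v′) * (b * c)
             ≡ (u * a + v * b) * (u′ * a + v′ * c)
  identity = solve-∀

Bézout-^ʳ : ∀ {a b} → Bézout a b → ∀ n → Bézout a (b ^ n)
Bézout-^ʳ _      zero    = 0ℤ , 1ℤ , refl
Bézout-^ʳ bézout (suc n) = Bézout-*ʳ bézout (Bézout-^ʳ bézout n)

Bézout-^ : ∀ {a b} → Bézout a b → ∀ m n → Bézout (a ^ m) (b ^ n)
Bézout-^ bézout m n = Bézout-sym (Bézout-^ʳ (Bézout-sym (Bézout-^ʳ bézout n)) m)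

Bézout-∣ʳ : ∀ {a b c} → b ∣ c → Bézout a c → Bézout a b
Bézout-∣ʳ {a} {b} (divides j refl) (u , v , eq) = u , v * j , trans (identity u v a b j) eq
  where
  identity : ∀ u v a b j → u * a + v * j * b ≡ u * a + v * (j * b)
  identity = solve-∀

Bézout⇒*∣ : ∀ {a b x} → Bézout a b → a ∣ x → b ∣ x → a * b ∣ x
Bézout⇒*∣ {a} {b} {x} (u , v , eq) (divides j refl) (divides k x≡kb) =
  divides (u * k + v * j) (begin
    j * a                            ≡⟨ ℤ.*-identityʳ (j * a) ⟨
    j * a * 1ℤ                       ≡⟨ cong (j * a *_) eq ⟨
    j * a * (u * a + v * b)          ≡⟨ identity u v a b j ⟩
    u * (j * a) * a + v * j * a * b  ≡⟨ cong (λ y → u * y * a + v * j * a * b) x≡kb ⟩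
    u * (k * b) * a + v * j * a * b  ≡⟨ identity′ u v a b j k ⟩
    (u * k + v * j) * (a * b)        ∎)
  where
  open ≡-Reasoning
  identity : ∀ u v a b j → j * a * (u * a + v * b) ≡ u * (j * a) * a + v * j * a * b
  identity = solve-∀
  identity′ : ∀ u v a b j k → u * (k * b) * a + v * j * a * b ≡ (u * k + v * j) * (a * b)
  identity′ = solve-∀

≋-combine : ∀ {a b A B} → Bézout a b → A ≋[ a ] B → A ≋[ b ] B → A ≋[ a * b ] B
≋-combine {a} {b} bézout p q = entries (combine (a≋ p) (a≋ q)) (combine (b≋ p) (b≋ q))
                               (combine (c≋ p) (c≋ q)) (combine (d≋ p) (d≋ q))
  where
  combine : ∀ {x y} → x ≡[ a ] y → x ≡[ b ] y → x ≡[ a * b ] y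
  combine (mod p) (mod q) = mod (Bézout⇒*∣ bézout p q)

crt : ∀ {a m} → Bézout a m → Σ (ℤ → ℤ) λ f → (∀ x → f x ≡[ a ] x) × (∀ x → m ∣ f x)
crt {a} {m} (u , v , eq) = (λ x → x * (v * m)) , congruent , divisible
  where
  congruent : ∀ x → x * (v * m) ≡[ a ] x
  congruent x = mod (divides (- (x * u)) (begin
    x * (v * m) - x                   ≡⟨ identity x u v a m ⟩
    - (x * u) * a + x * (u * a + v * m - 1ℤ) ≡⟨ cong (λ y → - (x * u) * a + x * (y - 1ℤ)) eq ⟩
    - (x * u) * a + x * 0ℤ            ≡⟨ identity′ x u a ⟩
    - (x * u) * a                     ∎))
    where
    open ≡-Reasoning
    identity : ∀ x u v a m → x * (v * m) - x ≡ - (x * u) * a + x * (u * a + v * m - 1ℤ)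
    identity = solve-∀
    identity′ : ∀ x u a → - (x * u) * a + x * 0ℤ ≡ - (x * u) * a
    identity′ = solve-∀
  divisible : ∀ x → m ∣ x * (v * m)
  divisible x = divides (x * v) (sym (ℤ.*-assoc x v m))

m∣D^s*q×q⊥D : ∀ D → D ≢ 0 → ∀ m → m ≢ 0 → ∃₂ λ s q → m ℕ.∣ D ℕ.^ s ℕ.* q × ℕ.Coprime q D
m∣D^s*q×q⊥D D D≢0 = <-rec _ split
  where
  split : ∀ m → (∀ {j} → j ℕ.< m → j ≢ 0 → ∃₂ λ s q → j ℕ.∣ D ℕ.^ s ℕ.* q × ℕ.Coprime q D) →
          m ≢ 0 → ∃₂ λ s q → m ℕ.∣ D ℕ.^ s ℕ.* q × ℕ.Coprime q D
  split m rec m≢0 with ℕ.gcd m D in gcd≡g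
  ... | zero = ⊥-elim (ℕ.gcd[m,n]≢0 m D (inj₂ D≢0) gcd≡g)
  ... | suc zero = 0 , m , ℕ.∣-reflexive (sym (ℕ.+-identityʳ m)) , ℕ.gcd≡1⇒coprime gcd≡g
  ... | suc (suc g) with subst (ℕ._∣ m) gcd≡g (ℕ.gcd[m,n]∣m m D)
  ...   | ℕ.divides zero    m≡0 = ⊥-elim (m≢0 m≡0)
  ...   | ℕ.divides (suc j) m≡j*g with rec j<m (λ ())
    where
    j<m : suc j ℕ.< m
    j<m = subst (suc j ℕ.<_) (sym m≡j*g) (ℕ.m<m*n (suc j) (suc (suc g)) (ℕ.s≤s (ℕ.s≤s ℕ.z≤n)))
  ...     | s , q , j∣D^s*q , q⊥D = suc s , q , m∣D^[1+s]*q , q⊥D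
    where
    g∣D : suc (suc g) ℕ.∣ D
    g∣D = subst (ℕ._∣ D) gcd≡g (ℕ.gcd[m,n]∣n m D)
    m∣D^[1+s]*q : m ℕ.∣ D ℕ.^ suc s ℕ.* q
    m∣D^[1+s]*q = subst₂ ℕ._∣_ (sym m≡j*g) (identity (D ℕ.^ s) q D) (ℕ.*-pres-∣ j∣D^s*q g∣D)
      where
      identity : ∀ x q D → x ℕ.* q ℕ.* D ≡ D ℕ.* x ℕ.* q
      identity = ℕ.solve-∀

Bézout-fromℕ : ∀ {m n} → ℕ.Coprime m n → Bézout (+ m) (+ n)
Bézout-fromℕ {m} {n} m⊥n with ℕ.coprime-Bézout m⊥n
... | ℕ.Bézout.+- x y 1+yn≡xm = + x , - + y , (begin
  + x * + m + - + y * + n     ≡⟨ cong (λ u → u + - + y * + n) (ℤ.pos-* x m) ⟨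
  + (x ℕ.* m) + - + y * + n   ≡⟨ cong (λ u → + u + - + y * + n) 1+yn≡xm ⟨
  + (1 ℕ.+ y ℕ.* n) + - + y * + n ≡⟨ cong (λ u → 1ℤ + u + - + y * + n) (ℤ.pos-* y n) ⟩
  1ℤ + + y * + n + - + y * + n ≡⟨ identity (+ y) (+ n) ⟩
  1ℤ                          ∎)
  where
  open ≡-Reasoning
  identity : ∀ y n → 1ℤ + y * n + (- y) * n ≡ 1ℤ
  identity = solve-∀
... | ℕ.Bézout.-+ x y 1+xm≡yn = - + x , + y , (begin
  - + x * + m + + y * + n     ≡⟨ cong (λ u → - + x * + m + u) (ℤ.pos-* y n) ⟨
  - + x * + m + + (y ℕ.* n)   ≡⟨ cong (λ u → - + x * + m + + u) 1+xm≡yn ⟨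
  - + x * + m + + (1 ℕ.+ x ℕ.* m) ≡⟨ cong (λ u → - + x * + m + (1ℤ + u)) (ℤ.pos-* x m) ⟩
  - + x * + m + (1ℤ + + x * + m) ≡⟨ identity (+ x) (+ m) ⟩
  1ℤ                          ∎)
  where
  open ≡-Reasoning
  identity : ∀ x m → (- x) * m + (1ℤ + x * m) ≡ 1ℤ
  identity = solve-∀

pos-^ : ∀ m n → + (m ℕ.^ n) ≡ (+ m) ^ n
pos-^ m zero    = refl
pos-^ m (suc n) = trans (ℤ.pos-* m (m ℕ.^ n)) (cong (+ m *_) (pos-^ m n))

^-distribʳ-* : ∀ x y n → (x * y) ^ n ≡ x ^ n * y ^ n
^-distribʳ-* x y zero    = refl
^-distribʳ-* x y (suc n) = trans (cong (x * y *_) (^-distribʳ-* x y n)) (identity x y (x ^ n) (y ^ n))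
  where
  identity : ∀ x y u v → x * y * (u * v) ≡ x * u * (y * v)
  identity = solve-∀

pos-[m*n]^k*q : ∀ m n k q → + ((m ℕ.* n) ℕ.^ k ℕ.* q) ≡ ((+ m) ^ k * (+ n) ^ k) * + q
pos-[m*n]^k*q m n k q = begin
  + ((m ℕ.* n) ℕ.^ k ℕ.* q)       ≡⟨ ℤ.pos-* ((m ℕ.* n) ℕ.^ k) q ⟩
  + ((m ℕ.* n) ℕ.^ k) * + q       ≡⟨ cong (_* + q) (pos-^ (m ℕ.* n) k) ⟩
  (+ (m ℕ.* n)) ^ k * + q         ≡⟨ cong (λ x → x ^ k * + q) (ℤ.pos-* m n) ⟩
  (+ m * + n) ^ k * + q           ≡⟨ cong (_* + q) (^-distribʳ-* (+ m) (+ n) k) ⟩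
  ((+ m) ^ k * (+ n) ^ k) * + q   ∎
  where open ≡-Reasoning

-- Generation of SL₂(ℤ) by elementary matrices

E : Bool → ℤ → Mat
E true  x = mat 1ℤ x 0ℤ 1ℤ
E false x = mat 1ℤ 0ℤ x 1ℤ

E-+ : ∀ t x y → E t x · E t y ≡ E t (x + y)
E-+ true  x y = mat-cong (one x) (sum x y) (zero′ x) (one′ y)
  where
  one : ∀ x → 1ℤ * 1ℤ + x * 0ℤ ≡ 1ℤ
  one = solve-∀
  sum : ∀ x y → 1ℤ * y + x * 1ℤ ≡ x + y
  sum = solve-∀
  zero′ : ∀ x → 0ℤ * 1ℤ + 1ℤ * 0ℤ ≡ 0ℤ
  zero′ = solve-∀
  one′ : ∀ y → 0ℤ * y + 1ℤ * 1ℤ ≡ 1ℤ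
  one′ = solve-∀
E-+ false x y = mat-cong (one y) (zero′ x) (sum x y) (one′ x)
  where
  one : ∀ y → 1ℤ * 1ℤ + 0ℤ * y ≡ 1ℤ
  one = solve-∀
  zero′ : ∀ x → 1ℤ * 0ℤ + 0ℤ * 1ℤ ≡ 0ℤ
  zero′ = solve-∀
  sum : ∀ x y → x * 1ℤ + 1ℤ * y ≡ x + y
  sum = solve-∀
  one′ : ∀ x → x * 0ℤ + 1ℤ * 1ℤ ≡ 1ℤ
  one′ = solve-∀

E-0 : ∀ t → E t 0ℤ ≡ I
E-0 true  = refl
E-0 false = refl

E-inv : ∀ t x → inv (E t x) ≡ E t (- x)
E-inv true  x = refl
E-inv false x = refl

SL₂-E : ∀ t x → SL₂ (E t x)
SL₂-E true  x = identity x
  where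
  identity : ∀ x → 1ℤ * 1ℤ - x * 0ℤ ≡ 1ℤ
  identity = solve-∀
SL₂-E false x = identity x
  where
  identity : ∀ x → 1ℤ * 1ℤ - 0ℤ * x ≡ 1ℤ
  identity = solve-∀

E-≋ : ∀ {m} t {x y} → x ≡[ m ] y → E t x ≋[ m ] E t y
E-≋ true  x≡y = entries ≡[]-refl x≡y ≡[]-refl ≡[]-refl
E-≋ false x≡y = entries ≡[]-refl ≡[]-refl x≡y ≡[]-refl

E-≋I : ∀ {m} t {x} → m ∣ x → E t x ≋[ m ] I
E-≋I true  m∣x = E-≋ true  (Equivalence.to ∣⇔≡[]0 m∣x)
E-≋I false m∣x = E-≋ false (Equivalence.to ∣⇔≡[]0 m∣x)

Word : Set
Word = List (Bool × ℤ)

eval : Word → Mat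
eval []            = I
eval ((t , x) ∷ w) = E t x · eval w

eval-++ : ∀ w w′ → eval (w ++ w′) ≡ eval w · eval w′
eval-++ []            w′ = sym (·-identityˡ (eval w′))
eval-++ ((t , x) ∷ w) w′ = trans (cong (E t x ·_) (eval-++ w w′)) (sym (·-assoc (E t x) (eval w) (eval w′)))

S : Mat
S = mat 0ℤ -1ℤ 1ℤ 0ℤ

S-word : Word
S-word = (true , -1ℤ) ∷ (false , 1ℤ) ∷ (true , -1ℤ) ∷ []

S⁻¹-word : Word
S⁻¹-word = (true , 1ℤ) ∷ (false , -1ℤ) ∷ (true , 1ℤ) ∷ []

S·E[-x]·S⁻¹≡E[x] : ∀ x → (S · inv (E true x)) · inv S ≡ E false x
S·E[-x]·S⁻¹≡E[x] x = mat-cong (entry₁ x) (entry₂ x) (entry₃ x) (entry₄ x)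
  where
  entry₁ : ∀ x → (0ℤ * 1ℤ + -1ℤ * 0ℤ) * 0ℤ + (0ℤ * (- x) + -1ℤ * 1ℤ) * (- 1ℤ) ≡ 1ℤ
  entry₁ = solve-∀
  entry₂ : ∀ x → (0ℤ * 1ℤ + -1ℤ * 0ℤ) * (- -1ℤ) + (0ℤ * (- x) + -1ℤ * 1ℤ) * 0ℤ ≡ 0ℤ
  entry₂ = solve-∀
  entry₃ : ∀ x → (1ℤ * 1ℤ + 0ℤ * 0ℤ) * 0ℤ + (1ℤ * (- x) + 0ℤ * 1ℤ) * (- 1ℤ) ≡ x
  entry₃ = solve-∀
  entry₄ : ∀ x → (1ℤ * 1ℤ + 0ℤ * 0ℤ) * (- -1ℤ) + (1ℤ * (- x) + 0ℤ * 1ℤ) * 0ℤ ≡ 1ℤ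
  entry₄ = solve-∀

∣i∣≡1⇒i≡±1 : ∀ i → ∣ i ∣ ≡ 1 → i ≡ 1ℤ ⊎ i ≡ -1ℤ
∣i∣≡1⇒i≡±1 (+ 1)           _  = inj₁ refl
∣i∣≡1⇒i≡±1 -[1+ 0 ]        _  = inj₂ refl
∣i∣≡1⇒i≡±1 (+ 0)           ()
∣i∣≡1⇒i≡±1 (+ suc (suc _)) ()
∣i∣≡1⇒i≡±1 -[1+ suc _ ]    ()

i*j≡1⇒i≡j≡±1 : ∀ i j → i * j ≡ 1ℤ → (i ≡ 1ℤ × j ≡ 1ℤ) ⊎ (i ≡ -1ℤ × j ≡ -1ℤ)
i*j≡1⇒i≡j≡±1 i j ij≡1 with ∣i∣≡1⇒i≡±1 i (ℕ.m*n≡1⇒m≡1 ∣ i ∣ ∣ j ∣ ∣i∣∣j∣≡1)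
                         | ∣i∣≡1⇒i≡±1 j (ℕ.m*n≡1⇒n≡1 ∣ i ∣ ∣ j ∣ ∣i∣∣j∣≡1)
  where
  ∣i∣∣j∣≡1 : ∣ i ∣ ℕ.* ∣ j ∣ ≡ 1
  ∣i∣∣j∣≡1 = trans (sym (ℤ.abs-* i j)) (cong ∣_∣ ij≡1)
... | inj₁ refl | inj₁ refl = inj₁ (refl , refl)
... | inj₂ refl | inj₂ refl = inj₂ (refl , refl)
i*j≡1⇒i≡j≡±1 _ _ () | inj₁ refl | inj₂ refl
i*j≡1⇒i≡j≡±1 _ _ () | inj₂ refl | inj₁ refl

upper-triangular : ∀ a b d → SL₂ (mat a b 0ℤ d) → ∃ λ w → eval w ≡ mat a b 0ℤ d
upper-triangular a b d det≡1 with i*j≡1⇒i≡j≡±1 a d (trans (sym (identity a b d)) det≡1)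
  where
  identity : ∀ a b d → a * d - b * 0ℤ ≡ a * d
  identity = solve-∀
... | inj₁ (refl , refl) = (true , b) ∷ [] , ·-identityʳ (E true b)
... | inj₂ (refl , refl) = (true , - b) ∷ S-word ++ S-word , (begin
  E true (- b) · neg I   ≡⟨ neg-distribʳ-· (E true (- b)) I ⟩
  neg (E true (- b) · I) ≡⟨ cong neg (·-identityʳ (E true (- b))) ⟩
  neg (E true (- b))     ≡⟨ mat-cong refl (ℤ.neg-involutive b) refl refl ⟩
  mat -1ℤ b 0ℤ -1ℤ       ∎)
  where open ≡-Reasoning

-- Euclidean step: if a = r + q c then A = E q · S⁻¹ · A′, where A′ has lower-left entry r.
euclid-step : ∀ q r b c d w → eval w ≡ mat (- c) (- d) r (b - q * d) →
              eval ((true , q) ∷ S⁻¹-word ++ w) ≡ mat (r + q * c) b c d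
euclid-step q r b c d w w≡A′ = begin
  E true q · eval (S⁻¹-word ++ w)                 ≡⟨ cong (E true q ·_) (eval-++ S⁻¹-word w) ⟩
  E true q · (inv S · eval w)                     ≡⟨ cong (λ X → E true q · (inv S · X)) w≡A′ ⟩
  E true q · (inv S · mat (- c) (- d) r (b - q * d)) ≡⟨ mat-cong (entry₁ q r c) (entry₂ q b d) (entry₃ c r) (entry₄ b d q) ⟩
  mat (r + q * c) b c d                           ∎
  where
  open ≡-Reasoning
  entry₁ : ∀ q r c → 1ℤ * (0ℤ * (- c) + 1ℤ * r) + q * (-1ℤ * (- c) + 0ℤ * r) ≡ r + q * c
  entry₁ = solve-∀
  entry₂ : ∀ q b d → 1ℤ * (0ℤ * (- d) + 1ℤ * (b - q * d)) + q * (-1ℤ * (- d) + 0ℤ * (b - q * d)) ≡ b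
  entry₂ = solve-∀
  entry₃ : ∀ c r → 0ℤ * (0ℤ * (- c) + 1ℤ * r) + 1ℤ * (-1ℤ * (- c) + 0ℤ * r) ≡ c
  entry₃ = solve-∀
  entry₄ : ∀ b d q → 0ℤ * (0ℤ * (- d) + 1ℤ * (b - q * d)) + 1ℤ * (-1ℤ * (- d) + 0ℤ * (b - q * d)) ≡ d
  entry₄ = solve-∀

det-euclid-step : ∀ q r b c d → det (mat (- c) (- d) r (b - q * d)) ≡ det (mat (r + q * c) b c d)
det-euclid-step = identity
  where
  identity : ∀ q r b c d → (- c) * (b - q * d) - (- d) * r ≡ (r + q * c) * d - b * c
  identity = solve-∀

decompose : ∀ A → SL₂ A → ∃ λ w → eval w ≡ A
decompose A = by-lower-left (suc ∣ c A ∣) A (ℕ.n<1+n ∣ c A ∣)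
  where
  by-lower-left : ∀ n A → ∣ c A ∣ ℕ.< n → SL₂ A → ∃ λ w → eval w ≡ A
  by-lower-left (suc n) (mat a b c d) ∣c∣<1+n det≡1 with c ℤ.≟ 0ℤ
  ... | yes refl = upper-triangular a b d det≡1
  ... | no c≢0 = extend (by-lower-left n A′ ∣r∣<n detA′≡1)
    where
    instance _ = ℤ.≢-nonZero c≢0
    q = a ℤ./ c
    r = a ℤ.% c
    a≡r+qc : a ≡ + r + q * c
    a≡r+qc = ℤ.a≡a%n+[a/n]*n a c
    A′ = mat (- c) (- d) (+ r) (b - q * d)
    ∣r∣<n : r ℕ.< n
    ∣r∣<n = ℕ.<-≤-trans (ℤ.n%d<d a c) (ℕ.≤-pred ∣c∣<1+n)
    detA′≡1 : SL₂ A′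
    detA′≡1 = trans (det-euclid-step q (+ r) b c d) (subst (λ x → SL₂ (mat x b c d)) a≡r+qc det≡1)
    extend : (∃ λ w → eval w ≡ A′) → ∃ λ w → eval w ≡ mat a b c d
    extend (w , w≡A′) = (true , q) ∷ S⁻¹-word ++ w ,
                        trans (euclid-step q (+ r) b c d w w≡A′) (cong (λ x → mat x b c d) (sym a≡r+qc))

data Elementary (m : ℤ) : Mat → Set where
  []  : Elementary m I
  _∷_ : ∀ {t x W} → m ∣ x → Elementary m W → Elementary m (E t x · W)

Elementary⊆ : ∀ {m} (P : Mat → Set) → P I → (∀ {A B} → P A → P B → P (A · B)) →
              (∀ t {x} → m ∣ x → P (E t x)) → ∀ {W} → Elementary m W → P W
Elementary⊆ P P-I P-· P-E []                      = P-I
Elementary⊆ P P-I P-· P-E (_∷_ {t} m∣x elementary) = P-· (P-E t m∣x) (Elementary⊆ P P-I P-· P-E elementary)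

Elementary⇒SL₂ : ∀ {m W} → Elementary m W → SL₂ W
Elementary⇒SL₂ = Elementary⊆ SL₂ refl (λ {A} {B} → SL₂-· A B) (λ t {x} _ → SL₂-E t x)

Elementary⇒≋I : ∀ {m W} → Elementary m W → W ≋[ m ] I
Elementary⇒≋I = Elementary⊆ (_≋[ _ ] I) ≋-refl ≋-· E-≋I

Elementary-∣ : ∀ {m m′ W} → m ∣ m′ → Elementary m′ W → Elementary m W
Elementary-∣ m∣m′ []                        = []
Elementary-∣ m∣m′ (_∷_ {t} m′∣x elementary) = _∷_ {t = t} (∣-trans m∣m′ m′∣x) (Elementary-∣ m∣m′ elementary)

-- Decompose A into elementary matrices and replace each entry x by its CRT modification f x.
approximate : ∀ {a m} → Bézout a m → ∀ A → SL₂ A → ∃ λ W → Elementary m W × W ≋[ a ] A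
approximate {a} {m} bézout A detA≡1 with decompose A detA≡1 | crt bézout
... | w , refl | f , fx≡x , m∣fx = approximate-word w
  where
  approximate-word : ∀ w → ∃ λ W → Elementary m W × W ≋[ a ] eval w
  approximate-word []            = I , [] , ≋-refl
  approximate-word ((t , x) ∷ w) with approximate-word w
  ... | W , elementary , W≋w = E t (f x) · W , _∷_ {t = t} (m∣fx x) elementary , ≋-· (E-≋ t (fx≡x x)) W≋w

infixl 30 _^ᴹ_

_^ᴹ_ : Mat → ℕ → Mat
A ^ᴹ zero  = I
A ^ᴹ suc n = A · A ^ᴹ n

^ᴹ-preserves : ∀ (P : Mat → Set) → P I → (∀ {A B} → P A → P B → P (A · B)) → ∀ {A} n → P A → P (A ^ᴹ n)
^ᴹ-preserves P P-I P-·     zero    P-A = P-I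
^ᴹ-preserves P P-I P-· {A} (suc n) P-A = P-· {A} {A ^ᴹ n} P-A (^ᴹ-preserves P P-I P-· {A} n P-A)

SL₂-^ᴹ : ∀ A n → SL₂ A → SL₂ (A ^ᴹ n)
SL₂-^ᴹ A = ^ᴹ-preserves SL₂ refl (λ {A} {B} → SL₂-· A B)

≋I-^ᴹ : ∀ {m A} n → A ≋[ m ] I → A ^ᴹ n ≋[ m ] I
≋I-^ᴹ = ^ᴹ-preserves (_≋[ _ ] I) ≋-refl ≋-·

^ᴹ-+ : ∀ A m n → A ^ᴹ (m ℕ.+ n) ≡ A ^ᴹ m · A ^ᴹ n
^ᴹ-+ A zero    n = sym (·-identityˡ (A ^ᴹ n))
^ᴹ-+ A (suc m) n = trans (cong (A ·_) (^ᴹ-+ A m n)) (sym (·-assoc A (A ^ᴹ m) (A ^ᴹ n)))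

^ᴹ-* : ∀ A m n → A ^ᴹ (m ℕ.* n) ≡ (A ^ᴹ n) ^ᴹ m
^ᴹ-* A zero    n = refl
^ᴹ-* A (suc m) n = trans (^ᴹ-+ A n (m ℕ.* n)) (cong (A ^ᴹ n ·_) (^ᴹ-* A m n))

I+[_]*[_-I] : ℕ → Mat → Mat
I+[ n ]*[ A -I] = mat (1ℤ + + n * (a A - 1ℤ)) (+ n * b A) (+ n * c A) (1ℤ + + n * (d A - 1ℤ))

^ᴹ-≋-binomial : ∀ {m A} n → A ≋[ m ] I → A ^ᴹ n ≋[ m * m ] I+[ n ]*[ A -I]
^ᴹ-≋-binomial {m} {A} zero    A≋I = entries (≡⇒≡[] (identity (a A))) (≡⇒≡[] (sym (ℤ.*-zeroˡ (b A))))
                                             (≡⇒≡[] (sym (ℤ.*-zeroˡ (c A)))) (≡⇒≡[] (identity (d A)))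
  where
  identity : ∀ x → 1ℤ ≡ 1ℤ + 0ℤ * (x - 1ℤ)
  identity = solve-∀
^ᴹ-≋-binomial {m} {A@(mat x y z w)} (suc n) A≋I =
  ≋-trans (≋-· (≋-refl {A = A}) (^ᴹ-≋-binomial n A≋I)) (entries
    (mod (subst (m * m ∣_) (sym (entry₁ (+ n) x y z)) (∣n⇒∣m*n (+ n) (∣m∣n⇒∣m+n (*-pres-∣ p p) (*-pres-∣ q r)))))
    (mod (subst (m * m ∣_) (sym (entry₂ (+ n) x y w)) (∣n⇒∣m*n (+ n) (∣m∣n⇒∣m+n (*-pres-∣ p q) (*-pres-∣ q s)))))
    (mod (subst (m * m ∣_) (sym (entry₃ (+ n) x z w)) (∣n⇒∣m*n (+ n) (∣m∣n⇒∣m+n (*-pres-∣ r p) (*-pres-∣ s r)))))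
    (mod (subst (m * m ∣_) (sym (entry₄ (+ n) y z w)) (∣n⇒∣m*n (+ n) (∣m∣n⇒∣m+n (*-pres-∣ r q) (*-pres-∣ s s))))))
  where
  p = ∣x-y (a≋ A≋I)
  q = Equivalence.from ∣⇔≡[]0 (b≋ A≋I)
  r = Equivalence.from ∣⇔≡[]0 (c≋ A≋I)
  s = ∣x-y (d≋ A≋I)
  entry₁ : ∀ n x y z → x * (1ℤ + n * (x - 1ℤ)) + y * (n * z) - (1ℤ + (1ℤ + n) * (x - 1ℤ))
                       ≡ n * ((x - 1ℤ) * (x - 1ℤ) + y * z)
  entry₁ = solve-∀
  entry₂ : ∀ n x y w → x * (n * y) + y * (1ℤ + n * (w - 1ℤ)) - (1ℤ + n) * y
                       ≡ n * ((x - 1ℤ) * y + y * (w - 1ℤ))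
  entry₂ = solve-∀
  entry₃ : ∀ n x z w → z * (1ℤ + n * (x - 1ℤ)) + w * (n * z) - (1ℤ + n) * z
                       ≡ n * (z * (x - 1ℤ) + (w - 1ℤ) * z)
  entry₃ = solve-∀
  entry₄ : ∀ n y z w → z * (n * y) + w * (1ℤ + n * (w - 1ℤ)) - (1ℤ + (1ℤ + n) * (w - 1ℤ))
                       ≡ n * (z * y + (w - 1ℤ) * (w - 1ℤ))
  entry₄ = solve-∀

I+[n]*[A-I]≋I : ∀ {m A} n → A ≋[ m ] I → I+[ n ]*[ A -I] ≋[ + n * m ] I
I+[n]*[A-I]≋I {m} {A} n A≋I = entries
  (mod (subst (+ n * m ∣_) (sym (identity (+ n) (a A))) (*-monoʳ-∣ (+ n) (∣x-y (a≋ A≋I)))))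
  (Equivalence.to ∣⇔≡[]0 (*-monoʳ-∣ (+ n) (Equivalence.from ∣⇔≡[]0 (b≋ A≋I))))
  (Equivalence.to ∣⇔≡[]0 (*-monoʳ-∣ (+ n) (Equivalence.from ∣⇔≡[]0 (c≋ A≋I))))
  (mod (subst (+ n * m ∣_) (sym (identity (+ n) (d A))) (*-monoʳ-∣ (+ n) (∣x-y (d≋ A≋I)))))
  where
  identity : ∀ n x → 1ℤ + n * (x - 1ℤ) - 1ℤ ≡ n * (x - 1ℤ)
  identity = solve-∀

^ᴹ-≋I-lift : ∀ {m A} n → A ≋[ m ] I → + n ∣ m → A ^ᴹ n ≋[ + n * m ] I
^ᴹ-≋I-lift {m} n A≋I n∣m =
  ≋-trans (≋-∣ (*-monoˡ-∣ m n∣m) (^ᴹ-≋-binomial n A≋I)) (I+[n]*[A-I]≋I n A≋I)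

^ᴹ-^-≋I : ∀ n t {A} → A ≋[ + n ] I → A ^ᴹ (n ℕ.^ t) ≋[ (+ n) ^ suc t ] I
^ᴹ-^-≋I n zero    {A} A≋I = ≋-∣ (divides 1ℤ (identity (+ n))) (≋-trans (≋-reflexive (·-identityʳ A)) A≋I)
  where
  identity : ∀ x → x ≡ 1ℤ * (x * 1ℤ)
  identity = solve-∀
^ᴹ-^-≋I n (suc t) {A} A≋I = subst (_≋[ (+ n) ^ suc (suc t) ] I) (sym (^ᴹ-* A n (n ℕ.^ t)))
  (^ᴹ-≋I-lift n (^ᴹ-^-≋I n t A≋I) (divides ((+ n) ^ t) (ℤ.*-comm (+ n) ((+ n) ^ t))))

-- Subgroups containing Γ(N)

record Admissible (N L : ℕ) (K : Mat → Set) : Set where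
  field
    K-I      : K I
    K-·      : ∀ {A B} → K A → K B → K (A · B)
    K-inv    : ∀ {A} → K A → K (inv A)
    K-square : ∀ A → Γ N A → K (A · A)
    K-conj   : ∀ W {A} → Γ N W → K A → K ((W · A) · inv W)
    K-Γ[L]   : ∀ A → Γ L A → K A
    K-T^N    : K (Tpow N)

module Admissible⇒Γ⊆-split {N L K} (admissible : Admissible N L K)
  (k : ℕ) (N≡1+2k : N ≡ suc (k ℕ.+ k))
  (e q : ℕ) (L∣2^[1+e]*N^[1+e]*q : + L ∣ ((+ 2) ^ suc e * (+ N) ^ suc e) * + q)
  (q⊥2 : Bézout (+ q) (+ 2)) (q⊥N : Bézout (+ q) (+ N))
  where

  open Admissible admissible

  P₂ Pₙ Q : ℤ
  P₂ = (+ 2) ^ suc e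
  Pₙ = (+ N) ^ suc e
  Q  = + q

  P₂⊥Pₙ : Bézout P₂ Pₙ
  P₂⊥Pₙ = Bézout-^ 2⊥N (suc e) (suc e)
    where
    2⊥N : Bézout (+ 2) (+ N)
    2⊥N = - + k , 1ℤ , trans (cong (λ n → - + k * + 2 + 1ℤ * + n) N≡1+2k) (identity (+ k))
      where
      identity : ∀ k → - k * + 2 + 1ℤ * (1ℤ + (k + k)) ≡ 1ℤ
      identity = solve-∀

  P₂⊥Pₙ*Q : Bézout P₂ (Pₙ * Q)
  P₂⊥Pₙ*Q = Bézout-*ʳ P₂⊥Pₙ (Bézout-sym (Bézout-^ʳ q⊥2 (suc e)))

  Q⊥P₂*Pₙ : Bézout Q (P₂ * Pₙ)
  Q⊥P₂*Pₙ = Bézout-*ʳ (Bézout-^ʳ q⊥2 (suc e)) (Bézout-^ʳ q⊥N (suc e))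

  N∣Pₙ : + N ∣ Pₙ
  N∣Pₙ = divides ((+ N) ^ e) (ℤ.*-comm (+ N) ((+ N) ^ e))

  K-A^N⇒K-A : ∀ A → SL₂ A → A ≋[ + N ] I → K (A ^ᴹ N) → K A
  K-A^N⇒K-A A detA≡1 A≋I K-A^N =
    subst K ([A·B]·B⁻¹≡A A (A ^ᴹ (k ℕ.+ k)) (SL₂-^ᴹ A (k ℕ.+ k) detA≡1)) (K-· K-A^[1+2k] (K-inv K-A^[2k]))
    where
    K-A^[1+2k] : K (A ^ᴹ suc (k ℕ.+ k))
    K-A^[1+2k] = subst (λ n → K (A ^ᴹ n)) N≡1+2k K-A^N
    K-A^[2k] : K (A ^ᴹ (k ℕ.+ k))
    K-A^[2k] = subst K (sym (^ᴹ-+ A k k)) (K-square (A ^ᴹ k) (SL₂×≋I⇒Γ (SL₂-^ᴹ A k detA≡1) (≋I-^ᴹ k A≋I)))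

  K-A^N^s⇒K-A : ∀ s A → SL₂ A → A ≋[ + N ] I → K (A ^ᴹ (N ℕ.^ s)) → K A
  K-A^N^s⇒K-A zero    A _       _   K-A·I = subst K (·-identityʳ A) K-A·I
  K-A^N^s⇒K-A (suc s) A detA≡1 A≋I K-A^N^[1+s] =
    K-A^N^s⇒K-A s A detA≡1 A≋I (K-A^N⇒K-A (A ^ᴹ (N ℕ.^ s)) (SL₂-^ᴹ A (N ℕ.^ s) detA≡1) (≋I-^ᴹ (N ℕ.^ s) A≋I)
      (subst K (^ᴹ-* A N (N ℕ.^ s)) K-A^N^[1+s]))

  K-E[2N*] : ∀ t {x} → + 2 * + N ∣ x → K (E t x)
  K-E[2N*] t {x} (divides j refl) = subst K E[h]·E[h]≡E[x] (K-square (E t h) (SL₂×≋I⇒Γ (SL₂-E t h) (E-≋I t N∣h)))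
    where
    h = j * + N
    N∣h : + N ∣ h
    N∣h = divides j refl
    E[h]·E[h]≡E[x] : E t h · E t h ≡ E t (j * (+ 2 * + N))
    E[h]·E[h]≡E[x] = trans (E-+ t h h) (cong (E t) (identity j (+ N)))
      where
      identity : ∀ j n → j * n + j * n ≡ j * (+ 2 * n)
      identity = solve-∀

  -- Squares of elementary matrices (2N divides their entries) make X ≡ I (mod q); the N^e-th
  -- power of the result is then ≡ I modulo P₂ Pₙ Q, hence lies in Γ(L).
  ≋I[P₂]⇒K : ∀ X → SL₂ X → X ≋[ + N ] I → X ≋[ P₂ ] I → K X
  ≋I[P₂]⇒K X detX≡1 X≋I[N] X≋I[P₂] = from-approximation (approximate (Bézout-*ʳ q⊥2 Q⊥P₂*Pₙ) X detX≡1)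
    where
    from-approximation : (∃ λ W → Elementary (+ 2 * (P₂ * Pₙ)) W × W ≋[ Q ] X) → K X
    from-approximation (W , W-elem , W≋X) = subst K ([A·B⁻¹]·B≡A X W detW≡1) (K-· K-X₁ K-W)
      where
      detW≡1 = Elementary⇒SL₂ W-elem
      W≋I = Elementary⇒≋I W-elem
      K-W : K W
      K-W = Elementary⊆ K K-I K-· K-E[2N*] (Elementary-∣ (*-monoʳ-∣ (+ 2) (∣n⇒∣m*n P₂ N∣Pₙ)) W-elem)
      X₁ = X · inv W
      detX₁≡1 : SL₂ X₁
      detX₁≡1 = SL₂-· X (inv W) detX≡1 (SL₂-inv W detW≡1)
      X₁≋I[N] : X₁ ≋[ + N ] I
      X₁≋I[N] = ≋-· X≋I[N] (≋-inv (≋-∣ (∣n⇒∣m*n (+ 2) (∣n⇒∣m*n P₂ N∣Pₙ)) W≋I))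
      X₁≋I[P₂] : X₁ ≋[ P₂ ] I
      X₁≋I[P₂] = ≋-· X≋I[P₂] (≋-inv (≋-∣ (∣n⇒∣m*n (+ 2) (∣m⇒∣m*n Pₙ ∣-refl)) W≋I))
      X₁≋I[Q] : X₁ ≋[ Q ] I
      X₁≋I[Q] = ≋-trans (≋-· (≋-refl {A = X}) (≋-inv W≋X)) (≋-reflexive (·-inverseʳ X detX≡1))
      Y = X₁ ^ᴹ (N ℕ.^ e)
      Y≋I[L] : Y ≋[ + L ] I
      Y≋I[L] = ≋-∣ L∣2^[1+e]*N^[1+e]*q (≋-combine (Bézout-sym Q⊥P₂*Pₙ)
        (≋-combine P₂⊥Pₙ (≋I-^ᴹ (N ℕ.^ e) X₁≋I[P₂]) (^ᴹ-^-≋I N e X₁≋I[N]))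
        (≋I-^ᴹ (N ℕ.^ e) X₁≋I[Q]))
      K-X₁ : K X₁
      K-X₁ = K-A^N^s⇒K-A e X₁ detX₁≡1 X₁≋I[N] (K-Γ[L] Y (SL₂×≋I⇒Γ (SL₂-^ᴹ X₁ (N ℕ.^ e) detX₁≡1) Y≋I[L]))

  K-E[n*] : ∀ t {y} → K (E t y) → ∀ n → K (E t (+ n * y))
  K-E[n*] t {y} K-E[y] zero    = subst K (sym (E-0 t)) K-I
  K-E[n*] t {y} K-E[y] (suc n) =
    subst K (trans (E-+ t y (+ n * y)) (cong (E t) (identity (+ n) y))) (K-· K-E[y] (K-E[n*] t K-E[y] n))
    where
    identity : ∀ n y → y + n * y ≡ (1ℤ + n) * y
    identity = solve-∀

  K-E[j*] : ∀ t {y} → K (E t y) → ∀ j → K (E t (j * y))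
  K-E[j*] t K-E[y] (+ n)    = K-E[n*] t K-E[y] n
  K-E[j*] t {y} K-E[y] -[1+ n ] =
    subst K (trans (E-inv t (+ suc n * y)) (cong (E t) (ℤ.neg-distribˡ-* (+ suc n) y)))
      (K-inv (K-E[n*] t K-E[y] (suc n)))

  -- U^N = S T^(−N) S⁻¹; conjugating by some W ∈ Γ(N) with W ≡ S (mod P₂) instead gives an
  -- element of K that differs from U^N by a factor ≡ I (mod P₂).
  K-E[N] : ∀ t → K (E t (+ N))
  K-E[N] true  = K-T^N
  K-E[N] false = from-approximation (approximate P₂⊥Pₙ*Q S refl)
    where
    U = E false (+ N)
    from-approximation : (∃ λ W → Elementary (Pₙ * Q) W × W ≋[ P₂ ] S) → K U
    from-approximation (W , W-elem , W≋S) = subst K ([A·B⁻¹]·B≡A U Y detY≡1) (K-· K-C K-Y)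
      where
      detW≡1 = Elementary⇒SL₂ W-elem
      W≋I[N] : W ≋[ + N ] I
      W≋I[N] = ≋-∣ (∣m⇒∣m*n Q N∣Pₙ) (Elementary⇒≋I W-elem)
      Y = (W · inv (Tpow N)) · inv W
      K-Y : K Y
      K-Y = K-conj W (SL₂×≋I⇒Γ detW≡1 W≋I[N]) (K-inv K-T^N)
      detY≡1 : SL₂ Y
      detY≡1 = SL₂-· (W · inv (Tpow N)) (inv W)
        (SL₂-· W (inv (Tpow N)) detW≡1 (SL₂-inv (Tpow N) (SL₂-E true (+ N)))) (SL₂-inv W detW≡1)
      Y≋I[N] : Y ≋[ + N ] I
      Y≋I[N] = ≋-· (≋-· W≋I[N] (≋-inv (E-≋I true ∣-refl))) (≋-inv W≋I[N])
      Y≋U[P₂] : Y ≋[ P₂ ] U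
      Y≋U[P₂] = ≋-trans (≋-· (≋-· W≋S (≋-refl {A = inv (Tpow N)})) (≋-inv W≋S))
                        (≋-reflexive (S·E[-x]·S⁻¹≡E[x] (+ N)))
      C = U · inv Y
      K-C : K C
      K-C = ≋I[P₂]⇒K C (SL₂-· U (inv Y) (SL₂-E false (+ N)) (SL₂-inv Y detY≡1))
        (≋-· (E-≋I false ∣-refl) (≋-inv Y≋I[N]))
        (≋-trans (≋-· (≋-refl {A = U}) (≋-inv Y≋U[P₂])) (≋-reflexive (·-inverseʳ U (SL₂-E false (+ N)))))

  K-E[N*] : ∀ t {x} → + N ∣ x → K (E t x)
  K-E[N*] t (divides j refl) = K-E[j*] t (K-E[N] t) j

  Γ⊆K : ∀ A → Γ N A → K A
  Γ⊆K A A∈Γ = from-approximation (approximate P₂⊥Pₙ*Q A detA≡1)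
    where
    detA≡1 = proj₁ (Equivalence.to (Γ⇔SL₂×≋I {N} {A}) A∈Γ)
    A≋I[N] = proj₂ (Equivalence.to (Γ⇔SL₂×≋I {N} {A}) A∈Γ)
    from-approximation : (∃ λ W → Elementary (Pₙ * Q) W × W ≋[ P₂ ] A) → K A
    from-approximation (W , W-elem , W≋A) = subst K (A·[A⁻¹·B]≡B W A detW≡1) (K-· K-W K-W⁻¹A)
      where
      detW≡1 = Elementary⇒SL₂ W-elem
      K-W : K W
      K-W = Elementary⊆ K K-I K-· K-E[N*] (Elementary-∣ (∣m⇒∣m*n Q N∣Pₙ) W-elem)
      K-W⁻¹A : K (inv W · A)
      K-W⁻¹A = ≋I[P₂]⇒K (inv W · A) (SL₂-· (inv W) A (SL₂-inv W detW≡1) detA≡1)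
        (≋-· (≋-inv (≋-∣ (∣m⇒∣m*n Q N∣Pₙ) (Elementary⇒≋I W-elem))) A≋I[N])
        (≋-trans (≋-· (≋-inv W≋A) (≋-refl {A = A})) (≋-reflexive (·-inverseˡ A detA≡1)))

odd⇒≡1+2k : ∀ {N} → N % 2 ≡ 1 → N ≡ suc (N ℕ./ 2 ℕ.+ N ℕ./ 2)
odd⇒≡1+2k {N} N%2≡1 = begin
  N                            ≡⟨ ℕ.m≡m%n+[m/n]*n N 2 ⟩
  N % 2 ℕ.+ N ℕ./ 2 ℕ.* 2      ≡⟨ cong (ℕ._+ N ℕ./ 2 ℕ.* 2) N%2≡1 ⟩
  1 ℕ.+ N ℕ./ 2 ℕ.* 2          ≡⟨ identity (N ℕ./ 2) ⟩
  suc (N ℕ./ 2 ℕ.+ N ℕ./ 2)    ∎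
  where
  open ≡-Reasoning
  identity : ∀ k → 1 ℕ.+ k ℕ.* 2 ≡ suc (k ℕ.+ k)
  identity = ℕ.solve-∀

Admissible⇒Γ⊆ : ∀ {N L K} → N % 2 ≡ 1 → L ≢ 0 → Admissible N L K → ∀ A → Γ N A → K A
Admissible⇒Γ⊆ {N} {L} {K} N%2≡1 L≢0 admissible = from-splitting (m∣D^s*q×q⊥D (2 ℕ.* N) 2N≢0 L L≢0)
  where
  N≡1+2k = odd⇒≡1+2k N%2≡1
  2N≢0 : 2 ℕ.* N ≢ 0
  2N≢0 = subst (λ n → 2 ℕ.* n ≢ 0) (sym N≡1+2k) (λ ())
  from-splitting : (∃₂ λ s q → L ℕ.∣ (2 ℕ.* N) ℕ.^ s ℕ.* q × ℕ.Coprime q (2 ℕ.* N)) → ∀ A → Γ N A → K A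
  from-splitting (s , q , L∣[2N]^s*q , q⊥2N) =
    Admissible⇒Γ⊆-split.Γ⊆K admissible (N ℕ./ 2) N≡1+2k s q
      (subst (+ L ∣_) (pos-[m*n]^k*q 2 N (suc s) q) (∣ᵤ⇒∣ (ℕ.∣-trans L∣[2N]^s*q [2N]^s*q∣[2N]^[1+s]*q)))
      (Bézout-∣ʳ (∣ᵤ⇒∣ (ℕ.m∣m*n N)) (Bézout-fromℕ q⊥2N)) (Bézout-∣ʳ (∣ᵤ⇒∣ (ℕ.n∣m*n 2)) (Bézout-fromℕ q⊥2N))
    where
    D = 2 ℕ.* N
    [2N]^s*q∣[2N]^[1+s]*q : D ℕ.^ s ℕ.* q ℕ.∣ D ℕ.^ suc s ℕ.* q
    [2N]^s*q∣[2N]^[1+s]*q = subst (D ℕ.^ s ℕ.* q ℕ.∣_) (sym (ℕ.*-assoc D (D ℕ.^ s) q)) (ℕ.n∣m*n D)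

Γ-∣ : ∀ {M M′ A} → M ℕ.∣ M′ → Γ M′ A → Γ M A
Γ-∣ M∣M′ (detA≡1 , p , q , r , s) =
  detA≡1 , ℕ.∣-trans M∣M′ p , ℕ.∣-trans M∣M′ q , ℕ.∣-trans M∣M′ r , ℕ.∣-trans M∣M′ s

module GoodLiftProperties {N G} (good : GoodLift N G) where

  open GoodLift good
  open IsLift lift
  open IsSubgroupSL₂ subgroup

  G⇒¬G-neg : ∀ {A} → G A → ¬ G (neg A)
  G⇒¬G-neg {A} G-A G-negA =
    no-minus-1 (subst G A·[-A]⁻¹≡-I (·-closed A (inv (neg A)) G-A (inv-closed (neg A) G-negA)))
    where
    A·[-A]⁻¹≡-I : A · inv (neg A) ≡ neg I
    A·[-A]⁻¹≡-I = trans (neg-distribʳ-· A (inv A)) (cong neg (·-inverseʳ A (⊆SL₂ A G-A)))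

  G-square : ∀ A → Γ N A → G (A · A)
  G-square A A∈Γ with image⊇ A A∈Γ
  ... | inj₁ G-A    = ·-closed A A G-A G-A
  ... | inj₂ G-negA = subst G (neg-·-neg A A) (·-closed (neg A) (neg A) G-negA G-negA)

  G-conj : ∀ W A → Γ N W → G A → G ((W · A) · inv W)
  G-conj W A W∈Γ G-A with image⊇ W W∈Γ
  ... | inj₁ G-W    = ·-closed (W · A) (inv W) (·-closed W A G-W G-A) (inv-closed W G-W)
  ... | inj₂ G-negW = subst G ±W·A·[±W]⁻¹ (·-closed (neg W · A) (inv (neg W))
                               (·-closed (neg W) A G-negW G-A) (inv-closed (neg W) G-negW))
    where
    ±W·A·[±W]⁻¹ : (neg W · A) · neg (inv W) ≡ (W · A) · inv W
    ±W·A·[±W]⁻¹ = trans (cong (_· neg (inv W)) (neg-distribˡ-· W A)) (neg-·-neg (W · A) (inv W))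

  G-conj-neg : ∀ W A → Γ N W → G (neg A) → G (neg ((W · A) · inv W))
  G-conj-neg W A W∈Γ G-negA = subst G W·[-A]·W⁻¹≡-[W·A·W⁻¹] (G-conj W (neg A) W∈Γ G-negA)
    where
    W·[-A]·W⁻¹≡-[W·A·W⁻¹] : (W · neg A) · inv W ≡ neg ((W · A) · inv W)
    W·[-A]·W⁻¹≡-[W·A·W⁻¹] = trans (cong (_· inv W) (neg-distribʳ-· W A)) (neg-distribˡ-· (W · A) (inv W))

Agree : (Mat → Set) → (Mat → Set) → Mat → Set
Agree G H A = (G A × H A) ⊎ (G (neg A) × H (neg A))

HasSign⇒Agree : ∀ {G H A} s → HasSign G A s → HasSign H A s → Agree G H A
HasSign⇒Agree Sign.+ G-A H-A       = inj₁ (G-A , H-A)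
HasSign⇒Agree Sign.- G-negA H-negA = inj₂ (G-negA , H-negA)

Agree-sym : ∀ {G H A} → Agree G H A → Agree H G A
Agree-sym (inj₁ (G-A , H-A))       = inj₁ (H-A , G-A)
Agree-sym (inj₂ (G-negA , H-negA)) = inj₂ (H-negA , G-negA)

module _ {N G₁ G₂} (good₁ : GoodLift N G₁) (good₂ : GoodLift N G₂) where

  private
    module G₁ = IsSubgroupSL₂ (IsLift.subgroup (GoodLift.lift good₁))
    module G₂ = IsSubgroupSL₂ (IsLift.subgroup (GoodLift.lift good₂))
    module L₁ = GoodLiftProperties good₁
    module L₂ = GoodLiftProperties good₂
    M₁ = proj₁ (GoodLift.congruence good₁)
    M₂ = proj₁ (GoodLift.congruence good₂)

  M₁*M₂≢0 : M₁ ℕ.* M₂ ≢ 0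
  M₁*M₂≢0 = ℕ.≢-nonZero⁻¹ _ {{ℕ.m*n≢0 M₁ M₂ {{ℕ.>-nonZero M₁≥1}} {{ℕ.>-nonZero M₂≥1}}}}
    where
    M₁≥1 = proj₁ (proj₂ (GoodLift.congruence good₁))
    M₂≥1 = proj₁ (proj₂ (GoodLift.congruence good₂))

  Agree-· : ∀ {A B} → Agree G₁ G₂ A → Agree G₁ G₂ B → Agree G₁ G₂ (A · B)
  Agree-· {A} {B} (inj₁ (a₁ , a₂)) (inj₁ (b₁ , b₂)) = inj₁ (G₁.·-closed A B a₁ b₁ , G₂.·-closed A B a₂ b₂)
  Agree-· {A} {B} (inj₁ (a₁ , a₂)) (inj₂ (b₁ , b₂)) =
    inj₂ (subst G₁ (neg-distribʳ-· A B) (G₁.·-closed A (neg B) a₁ b₁) ,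
          subst G₂ (neg-distribʳ-· A B) (G₂.·-closed A (neg B) a₂ b₂))
  Agree-· {A} {B} (inj₂ (a₁ , a₂)) (inj₁ (b₁ , b₂)) =
    inj₂ (subst G₁ (neg-distribˡ-· A B) (G₁.·-closed (neg A) B a₁ b₁) ,
          subst G₂ (neg-distribˡ-· A B) (G₂.·-closed (neg A) B a₂ b₂))
  Agree-· {A} {B} (inj₂ (a₁ , a₂)) (inj₂ (b₁ , b₂)) =
    inj₁ (subst G₁ (neg-·-neg A B) (G₁.·-closed (neg A) (neg B) a₁ b₁) ,
          subst G₂ (neg-·-neg A B) (G₂.·-closed (neg A) (neg B) a₂ b₂))

  Agree-inv : ∀ {A} → Agree G₁ G₂ A → Agree G₁ G₂ (inv A)
  Agree-inv {A} (inj₁ (a₁ , a₂)) = inj₁ (G₁.inv-closed A a₁ , G₂.inv-closed A a₂)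
  Agree-inv {A} (inj₂ (a₁ , a₂)) = inj₂ (G₁.inv-closed (neg A) a₁ , G₂.inv-closed (neg A) a₂)

  Agree-conj : ∀ W {A} → Γ N W → Agree G₁ G₂ A → Agree G₁ G₂ ((W · A) · inv W)
  Agree-conj W {A} W∈Γ (inj₁ (a₁ , a₂)) = inj₁ (L₁.G-conj W A W∈Γ a₁ , L₂.G-conj W A W∈Γ a₂)
  Agree-conj W {A} W∈Γ (inj₂ (a₁ , a₂)) = inj₂ (L₁.G-conj-neg W A W∈Γ a₁ , L₂.G-conj-neg W A W∈Γ a₂)

  Agree-Γ[M₁*M₂] : ∀ A → Γ (M₁ ℕ.* M₂) A → Agree G₁ G₂ A
  Agree-Γ[M₁*M₂] A A∈Γ = inj₁ (proj₂ (proj₂ (GoodLift.congruence good₁)) A (Γ-∣ {A = A} (ℕ.m∣m*n M₂) A∈Γ) ,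
                              proj₂ (proj₂ (GoodLift.congruence good₂)) A (Γ-∣ {A = A} (ℕ.n∣m*n M₁) A∈Γ))

  Agree-admissible : ∀ s → HasSign G₁ (Tpow N) s → HasSign G₂ (Tpow N) s →
                     Admissible N (M₁ ℕ.* M₂) (Agree G₁ G₂)
  Agree-admissible s T₁ T₂ = record
    { K-I      = inj₁ (G₁.has-I , G₂.has-I)
    ; K-·      = Agree-·
    ; K-inv    = Agree-inv
    ; K-square = λ A A∈Γ → inj₁ (L₁.G-square A A∈Γ , L₂.G-square A A∈Γ)
    ; K-conj   = Agree-conj
    ; K-Γ[L]   = Agree-Γ[M₁*M₂]
    ; K-T^N    = HasSign⇒Agree s T₁ T₂
    }

Agree⇒⊆ : ∀ {N G H} → GoodLift N G → (∀ A → Γ N A → Agree G H A) → ∀ {A} → G A → H A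
Agree⇒⊆ {N} {G} {H} good agree {A} G-A with IsLift.image⊆ (GoodLift.lift good) A G-A
... | inj₁ A∈Γ with agree A A∈Γ
...   | inj₁ (_ , H-A)    = H-A
...   | inj₂ (G-negA , _) = ⊥-elim (GoodLiftProperties.G⇒¬G-neg good G-A G-negA)
Agree⇒⊆ {N} {G} {H} good agree {A} G-A | inj₂ negA∈Γ with agree (neg A) negA∈Γ
...   | inj₁ (G-negA , _)    = ⊥-elim (GoodLiftProperties.G⇒¬G-neg good G-A G-negA)
...   | inj₂ (_ , H-negnegA) = subst H (neg-involutive A) H-negnegA

lemma6p1 : (N : ℕ) → N > 1 → N % 2 ≡ 1 →
    (G₁ G₂ : Mat → Set) → GoodLift N G₁ → GoodLift N G₂ →
    ∃ (λ s → HasSign G₁ (Tpow N) s × HasSign G₂ (Tpow N) s) →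
    (∀ A₀ → Γ N A₀ → (s : Sign) → HasSign G₁ A₀ s → HasSign G₂ A₀ s)
    × (∀ A → G₁ A ⇔ G₂ A)
lemma6p1 N _ N%2≡1 G₁ G₂ good₁ good₂ (s , T₁ , T₂) = same-sign , G₁⇔G₂
  where
  agree : ∀ A → Γ N A → Agree G₁ G₂ A
  agree = Admissible⇒Γ⊆ N%2≡1 (M₁*M₂≢0 good₁ good₂) (Agree-admissible good₁ good₂ s T₁ T₂)
  G₁⇔G₂ : ∀ A → G₁ A ⇔ G₂ A
  G₁⇔G₂ A = mk⇔ (Agree⇒⊆ good₁ agree) (Agree⇒⊆ good₂ (λ B B∈Γ → Agree-sym {G₁} {G₂} (agree B B∈Γ)))
  same-sign : ∀ A₀ → Γ N A₀ → (s : Sign) → HasSign G₁ A₀ s → HasSign G₂ A₀ s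
  same-sign A₀ _ Sign.+ = Equivalence.to (G₁⇔G₂ A₀)
  same-sign A₀ _ Sign.- = Equivalence.to (G₁⇔G₂ (neg A₀))
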